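{- Let $n_0\geqslant n_1$ be positive integers and let $p_0,p_1$ be integers with $\operatorname{mp}(Q_{n_0})\geqslant p_0$ and $\operatorname{mp}(Q_{n_1})\geqslant p_1$. Then $\operatorname{mp}(Q_n)\geqslant p_0+p_1$, where $n = n_0 + \max(p_0,2) + \max(p_1,2) - 1$.
   Context: $Q_m$ is the $m$-dimensional hypercube: vertex set $\{0,1\}^m$, two vertices adjacent iff they differ in exactly one coordinate. For a vertex $v$ and integer $k\geqslant 0$, $N_k[v]$ is the set of vertices at graph distance at most $k$ from $v$. A set $M$ of vertices is a multipacking if $|N_k[v]\cap M|\leqslant k$ for every vertex $v$ and every integer $k\geqslant 1$; $\operatorname{mp}(G)$ is the maximum size of a multipacking in $G$. -}

module Defs where

open import Data.Bool using (Bool; true; false)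
open import Data.Nat using (ℕ; zero; suc; _≤_; _≤?_)
open import Data.Vec using (Vec; []; _∷_)
open import Data.List using (List; length; filter)
open import Data.List.Relation.Unary.Unique.Propositional using (Unique)
open import Data.Integer using (ℤ; +_) renaming (_≤_ to _≤ℤ_)
open import Data.Product using (∃; _×_)

Vertex : ℕ → Set
Vertex m = Vec Bool m

-- Graph distance in Q_m, which is the Hamming distance
-- (number of coordinates in which the two words differ).
dist : ∀ {m} → Vertex m → Vertex m → ℕ
dist [] [] = zero
dist (true ∷ u) (true ∷ v) = dist u v
dist (false ∷ u) (false ∷ v) = dist u v
dist (true ∷ u) (false ∷ v) = suc (dist u v)
dist (false ∷ u) (true ∷ v) = suc (dist u v)

-- |N_k[v] ∩ M| for a finite vertex set M given as a duplicate-free list.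
ballCount : ∀ {m} → ℕ → Vertex m → List (Vertex m) → ℕ
ballCount k v M = length (filter (λ u → dist v u ≤? k) M)

IsMultipacking : (m : ℕ) → List (Vertex m) → Set
IsMultipacking m M =
  Unique M × (∀ (v : Vertex m) (k : ℕ) → 1 ≤ k → ballCount k v M ≤ k)

MpAtLeast : ℕ → ℤ → Set
MpAtLeast m p = ∃ λ (M : List (Vertex m)) → IsMultipacking m M × (p ≤ℤ + length M)

-- Place a multipacking M₀ of Q_{n₀}, truncated to a = max(p₀,2) points, in the subcube
-- Q_{n₀} × {0^L}, and M₁ (padded with zeros to length n₀, truncated to b = max(p₁,2) points) in
-- Q_{n₀} × {1^L}, where L = a + b - 1. A ball of radius k centred at (x, z) reaches the first copy
-- only after r = d(z, 0^L) steps and the second only after L - r steps, so it contains at most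
-- max(1, k - r) and max(1, k - (L - r)) of their points, and never more than a resp. b of them.
-- These bounds add up to at most k because L + 1 = a + b with a, b ≥ 2.

module Submission where

open import Defs

module HypercubeGluing where

  open import Data.Bool using (Bool; true; false)
  open import Data.Empty using (⊥-elim)
  open import Data.Integer as ℤ using (ℤ; +_; -[1+_]; +≤+; -≤+; ∣_∣)
  import Data.Integer.Properties as ℤ
  open import Data.List using (List; []; _∷_; length; filter; map; take; _++_)
  open import Data.List.Membership.Propositional.Properties using (∈-map⁻)
  open import Data.List.Relation.Binary.Disjoint.Propositional using (Disjoint)
  open import Data.List.Properties using (filter-none; filter-++; length-++; length-filter; length-map; length-take)
  open import Data.List.Relation.Binary.Sublist.Propositional.Properties using (filter⁺; take-⊆; length-mono-≤)
  import Data.List.Relation.Unary.All as All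
  import Data.List.Relation.Unary.All.Properties as All
  import Data.List.Relation.Unary.Unique.Propositional.Properties as Unique
  open import Data.Nat
  open import Data.Nat.Properties
  open import Algebra.Properties.CommutativeSemigroup +-commutativeSemigroup using (interchange)
  open import Data.Product using (∃; _×_; _,_; proj₁)
  open import Data.Sum using (_⊎_; inj₁; inj₂)
  open import Data.Vec as Vec using ([]; _∷_; replicate; splitAt)
  open import Data.Vec.Properties using (++-injectiveˡ; ++-injectiveʳ)
  open import Function using (id)
  open import Relation.Binary.PropositionalEquality
  open import Relation.Nullary using (yes; no)
  open import Relation.Unary using (Pred; Decidable)
  open ≤-Reasoning

  length-filter-map-≤ : ∀ {a b p q} {A : Set a} {B : Set b} {P : Pred B p} {Q : Pred A q}
    (P? : Decidable P) (Q? : Decidable Q) (f : A → B) (xs : List A) →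
    (∀ x → P (f x) → Q x) → length (filter P? (map f xs)) ≤ length (filter Q? xs)
  length-filter-map-≤ P? Q? f [] P⇒Q = z≤n
  length-filter-map-≤ P? Q? f (x ∷ xs) P⇒Q with P? (f x) | Q? x
  ... | yes _  | yes _  = s≤s (length-filter-map-≤ P? Q? f xs P⇒Q)
  ... | yes Pf | no ¬Qx = ⊥-elim (¬Qx (P⇒Q x Pf))
  ... | no _   | yes _  = m≤n⇒m≤1+n (length-filter-map-≤ P? Q? f xs P⇒Q)
  ... | no _   | no _   = length-filter-map-≤ P? Q? f xs P⇒Q

  dist-++ : ∀ {m l} (x u : Vertex m) (z w : Vertex l) →
    dist (x Vec.++ z) (u Vec.++ w) ≡ dist x u + dist z w
  dist-++ []          []          z w = refl
  dist-++ (true ∷ x)  (true ∷ u)  z w = dist-++ x u z w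
  dist-++ (false ∷ x) (false ∷ u) z w = dist-++ x u z w
  dist-++ (true ∷ x)  (false ∷ u) z w = cong suc (dist-++ x u z w)
  dist-++ (false ∷ x) (true ∷ u)  z w = cong suc (dist-++ x u z w)

  dist-false+dist-true : ∀ {l} (z : Vertex l) →
    dist z (replicate l false) + dist z (replicate l true) ≡ l
  dist-false+dist-true []          = refl
  dist-false+dist-true (false ∷ z) = trans (+-suc _ _) (cong suc (dist-false+dist-true z))
  dist-false+dist-true (true ∷ z)  = cong suc (dist-false+dist-true z)

  extend : ∀ {m} → Bool → (l : ℕ) → Vertex m → Vertex (m + l)
  extend c l x = x Vec.++ replicate l c

  extend-injective : ∀ {m} c l {x y : Vertex m} → extend c l x ≡ extend c l y → x ≡ y
  extend-injective c l {x} {y} = ++-injectiveˡ x y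

  extend-false≢extend-true : ∀ {m l} → 1 ≤ l → (x y : Vertex m) → extend false l x ≢ extend true l y
  extend-false≢extend-true (s≤s _) x y eq with ++-injectiveʳ x y eq
  ... | ()

  ballCount-++ : ∀ {m} k (v : Vertex m) (M N : List (Vertex m)) →
    ballCount k v (M ++ N) ≡ ballCount k v M + ballCount k v N
  ballCount-++ k v M N = trans (cong length (filter-++ P? M N)) (length-++ (filter P? M))
    where P? = λ u → dist v u ≤? k

  ballCount-take-≤ : ∀ {m} k (v : Vertex m) j (M : List (Vertex m)) →
    ballCount k v (take j M) ≤ ballCount k v M
  ballCount-take-≤ k v j M = length-mono-≤ (filter⁺ P? P? (λ { refl → id }) (take-⊆ j M))
    where P? = λ u → dist v u ≤? k

  -- The constraints on the number c of points that a ball of radius k meets in a copy of a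
  -- multipacking of size at most a lying at distance s from its centre.
  record Load (a s k c : ℕ) : Set where
    field
      ≤capacity : c ≤ a
      far       : k < s → c ≡ 0
      near      : c ≤ 1 ⊔ (k ∸ s)

  open Load

  ballCount-extend-Load : ∀ {m l a} {M : List (Vertex m)} → IsMultipacking m M → length M ≤ a →
    (c : Bool) (x : Vertex m) (z : Vertex l) (k : ℕ) →
    Load a (dist z (replicate l c)) k (ballCount k (x Vec.++ z) (map (extend c l) M))
  ballCount-extend-Load {m} {l} {a} {M} (_ , packing) |M|≤a c x z k = record
    { ≤capacity = begin
        length (filter P? (map (extend c l) M)) ≤⟨ length-filter P? (map (extend c l) M) ⟩
        length (map (extend c l) M)             ≡⟨ length-map (extend c l) M ⟩
        length M                                ≤⟨ |M|≤a ⟩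
        a                                       ∎
    ; far = λ k<s → cong length (filter-none P? (All.map⁺ (All.universal
              (λ u d≤k → <⇒≱ k<s (≤-trans (m≤n+m s (dist x u)) (shift u d≤k))) M)))
    ; near = ≤-trans
        (length-filter-map-≤ P? (λ u → dist x u ≤? 1 ⊔ (k ∸ s)) (extend c l) M
          (λ u d≤k → ≤-trans (m+n≤o⇒m≤o∸n (dist x u) (shift u d≤k)) (m≤n⊔m 1 (k ∸ s))))
        (packing x (1 ⊔ (k ∸ s)) (m≤m⊔n 1 (k ∸ s)))
    }
    where
    s = dist z (replicate l c)
    P? = λ v → dist (x Vec.++ z) v ≤? k
    shift : ∀ u → dist (x Vec.++ z) (extend c l u) ≤ k → dist x u + s ≤ k
    shift u = subst (_≤ k) (dist-++ x u z (replicate l c))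

  Load-≤-radius : ∀ {a s k c} → 1 ≤ k → Load a s k c → c ≤ k
  Load-≤-radius {s = s} {k} {c} 1≤k load = begin
    c           ≤⟨ near load ⟩
    1 ⊔ (k ∸ s) ≤⟨ ⊔-monoʳ-≤ 1 (m∸n≤m k s) ⟩
    1 ⊔ k       ≡⟨ m≤n⇒m⊔n≡n 1≤k ⟩
    k           ∎

  m≤1⊔[o∸n]⇒m≤1⊎m+n≤o : ∀ {m n o} → n ≤ o → m ≤ 1 ⊔ (o ∸ n) → m ≤ 1 ⊎ m + n ≤ o
  m≤1⊔[o∸n]⇒m≤1⊎m+n≤o {m} {n} {o} n≤o m≤ with ⊔-sel 1 (o ∸ n)
  ... | inj₁ eq = inj₁ (subst (m ≤_) eq m≤)
  ... | inj₂ eq = inj₂ (begin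
    m + n       ≤⟨ +-monoˡ-≤ n (subst (m ≤_) eq m≤) ⟩
    o ∸ n + n   ≡⟨ m∸n+n≡m n≤o ⟩
    o           ∎)

  both-shifted-+-≤ : ∀ {a b r r′ k c₀ c₁} → suc (r + r′) ≡ a + b →
    c₀ ≤ a → c₁ ≤ b → c₀ + r ≤ k → c₁ + r′ ≤ k → c₀ + c₁ ≤ k
  both-shifted-+-≤ {a} {b} {r} {r′} {k} {c₀} {c₁} split c₀≤a c₁≤b h₀ h₁ with k ≤? r + r′
  ... | yes k≤r+r′ = +-cancelʳ-≤ (r + r′) (c₀ + c₁) k (begin
    (c₀ + c₁) + (r + r′) ≡⟨ interchange c₀ c₁ r r′ ⟩
    (c₀ + r) + (c₁ + r′) ≤⟨ +-mono-≤ h₀ h₁ ⟩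
    k + k                ≤⟨ +-monoʳ-≤ k k≤r+r′ ⟩
    k + (r + r′)         ∎)
  ... | no k≰r+r′ = begin
    c₀ + c₁      ≤⟨ +-mono-≤ c₀≤a c₁≤b ⟩
    a + b        ≡⟨ split ⟨
    suc (r + r′) ≤⟨ ≰⇒> k≰r+r′ ⟩
    k            ∎

  single-shifted-+-≤ : ∀ {a b r r′ k c₀ c₁} → 2 ≤ a → suc (r + r′) ≡ a + b → r ≤ k →
    c₀ ≤ 1 → c₁ ≤ b → c₁ + r′ ≤ k → c₀ + c₁ ≤ k
  single-shifted-+-≤ {a} {b} {r} {zero} {k} {c₀} {c₁} 2≤a split r≤k c₀≤1 c₁≤b _ = begin
    c₀ + c₁ ≤⟨ +-mono-≤ c₀≤1 c₁≤b ⟩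
    1 + b   ≤⟨ ≤-pred (≤-trans (+-monoˡ-≤ b 2≤a) (≤-reflexive (sym split))) ⟩
    r + 0   ≡⟨ +-identityʳ r ⟩
    r       ≤⟨ r≤k ⟩
    k       ∎
  single-shifted-+-≤ {r′ = suc t} {k} {c₀} {c₁} _ _ _ c₀≤1 _ h₁ = begin
    c₀ + c₁     ≤⟨ +-monoˡ-≤ c₁ c₀≤1 ⟩
    suc c₁      ≤⟨ s≤s (m≤m+n c₁ t) ⟩
    suc (c₁ + t) ≡⟨ +-suc c₁ t ⟨
    c₁ + suc t  ≤⟨ h₁ ⟩
    k           ∎

  both-single-+-≤ : ∀ {r r′ k c₀ c₁} → 3 ≤ r + r′ → r ≤ k → r′ ≤ k →
    c₀ ≤ 1 → c₁ ≤ 1 → c₀ + c₁ ≤ k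
  both-single-+-≤ {k = k} 3≤r+r′ r≤k r′≤k c₀≤1 c₁≤1 =
    ≤-trans (+-mono-≤ c₀≤1 c₁≤1) (2≤k k (≤-trans 3≤r+r′ (+-mono-≤ r≤k r′≤k)))
    where
    2≤k : ∀ k → 3 ≤ k + k → 2 ≤ k
    2≤k 0 ()
    2≤k 1 (s≤s (s≤s ()))
    2≤k (suc (suc _)) _ = s≤s (s≤s z≤n)

  Load-+-≤ : ∀ {a b r r′ k c₀ c₁} → 2 ≤ a → 2 ≤ b → suc (r + r′) ≡ a + b → 1 ≤ k →
    Load a r k c₀ → Load b r′ k c₁ → c₀ + c₁ ≤ k
  Load-+-≤ {a} {b} {r} {r′} {k} {c₀} {c₁} 2≤a 2≤b split 1≤k load₀ load₁ with k <? r | k <? r′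
  ... | yes k<r | _ rewrite far load₀ k<r = Load-≤-radius 1≤k load₁
  ... | no _ | yes k<r′ rewrite far load₁ k<r′ | +-identityʳ c₀ = Load-≤-radius 1≤k load₀
  ... | no k≮r | no k≮r′ =
    cases (m≤1⊔[o∸n]⇒m≤1⊎m+n≤o r≤k (near load₀)) (m≤1⊔[o∸n]⇒m≤1⊎m+n≤o r′≤k (near load₁))
    where
    r≤k = ≮⇒≥ k≮r
    r′≤k = ≮⇒≥ k≮r′
    split′ : suc (r′ + r) ≡ b + a
    split′ = trans (cong suc (+-comm r′ r)) (trans split (+-comm a b))
    cases : c₀ ≤ 1 ⊎ c₀ + r ≤ k → c₁ ≤ 1 ⊎ c₁ + r′ ≤ k → c₀ + c₁ ≤ k
    cases (inj₁ c₀≤1) (inj₁ c₁≤1) = both-single-+-≤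
      (≤-pred (≤-trans (+-mono-≤ 2≤a 2≤b) (≤-reflexive (sym split)))) r≤k r′≤k c₀≤1 c₁≤1
    cases (inj₁ c₀≤1) (inj₂ h₁) = single-shifted-+-≤ 2≤a split r≤k c₀≤1 (≤capacity load₁) h₁
    cases (inj₂ h₀) (inj₁ c₁≤1) = subst (_≤ k) (+-comm c₁ c₀)
      (single-shifted-+-≤ 2≤b split′ r′≤k c₁≤1 (≤capacity load₀) h₀)
    cases (inj₂ h₀) (inj₂ h₁) = both-shifted-+-≤ split (≤capacity load₀) (≤capacity load₁) h₀ h₁

  take-IsMultipacking : ∀ {m} j {M : List (Vertex m)} → IsMultipacking m M → IsMultipacking m (take j M)
  take-IsMultipacking j {M} (unique , packing) =
    Unique.take⁺ j unique , λ v k 1≤k → ≤-trans (ballCount-take-≤ k v j M) (packing v k 1≤k)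

  extend-IsMultipacking : ∀ {m} c l {M : List (Vertex m)} →
    IsMultipacking m M → IsMultipacking (m + l) (map (extend c l) M)
  extend-IsMultipacking {m} c l {M} mp@(unique , _) = Unique.map⁺ (extend-injective c l) unique , packing
    where
    packing : ∀ v k → 1 ≤ k → ballCount k v (map (extend c l) M) ≤ k
    packing v k 1≤k with splitAt m v
    ... | x , z , refl = Load-≤-radius 1≤k (ballCount-extend-Load mp ≤-refl c x z k)

  glue-IsMultipacking : ∀ {m L a b} {M₀ M₁ : List (Vertex m)} → 2 ≤ a → 2 ≤ b → suc L ≡ a + b →
    IsMultipacking m M₀ → length M₀ ≤ a → IsMultipacking m M₁ → length M₁ ≤ b →
    IsMultipacking (m + L) (map (extend false L) M₀ ++ map (extend true L) M₁)
  glue-IsMultipacking {m} {L} {a} {b} {M₀} {M₁} 2≤a 2≤b split mp₀ |M₀|≤a mp₁ |M₁|≤b =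
    Unique.++⁺ (proj₁ (extend-IsMultipacking false L mp₀)) (proj₁ (extend-IsMultipacking true L mp₁))
      disjoint
    , packing
    where
    1≤L : 1 ≤ L
    1≤L = ≤-pred (≤-trans (≤-trans 2≤a (m≤m+n a b)) (≤-reflexive (sym split)))
    disjoint : Disjoint (map (extend false L) M₀) (map (extend true L) M₁)
    disjoint (v∈₀ , v∈₁) with ∈-map⁻ (extend false L) v∈₀ | ∈-map⁻ (extend true L) v∈₁
    ... | x , _ , refl | y , _ , eq = extend-false≢extend-true 1≤L x y eq
    packing : ∀ v k → 1 ≤ k → ballCount k v (map (extend false L) M₀ ++ map (extend true L) M₁) ≤ k
    packing v k 1≤k with splitAt m v
    ... | x , z , refl = begin
      ballCount k w (map (extend false L) M₀ ++ map (extend true L) M₁)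
        ≡⟨ ballCount-++ k w (map (extend false L) M₀) (map (extend true L) M₁) ⟩
      ballCount k w (map (extend false L) M₀) + ballCount k w (map (extend true L) M₁)
        ≤⟨ Load-+-≤ 2≤a 2≤b (trans (cong suc (dist-false+dist-true z)) split) 1≤k
             (ballCount-extend-Load mp₀ |M₀|≤a false x z k) (ballCount-extend-Load mp₁ |M₁|≤b true x z k) ⟩
      k ∎
      where w = x Vec.++ z

  MpAtLeast-truncate : ∀ {m p} a → p ℤ.≤ + a → MpAtLeast m p →
    ∃ λ (M : List (Vertex m)) → IsMultipacking m M × length M ≤ a × p ℤ.≤ + length M
  MpAtLeast-truncate {p = p} a p≤a (M , mp , p≤|M|) =
    take a M , take-IsMultipacking a mp ,
    subst (_≤ a) (sym (length-take a M)) (m⊓n≤m a (length M)) ,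
    subst (λ j → p ℤ.≤ + j) (sym (length-take a M)) (ℤ.⊓-glb p≤a p≤|M|)

  MpAtLeast-extend : ∀ {n₁ n₀ p} → n₁ ≤ n₀ → MpAtLeast n₁ p → MpAtLeast n₀ p
  MpAtLeast-extend {p = p} n₁≤n₀ (M , mp , p≤|M|) with m≤n⇒∃[o]m+o≡n n₁≤n₀
  ... | d , refl = map (extend false d) M , extend-IsMultipacking false d mp ,
                   subst (λ j → p ℤ.≤ + j) (sym (length-map (extend false d) M)) p≤|M|

  MpAtLeast-glue : ∀ {m a b p₀ p₁} → 2 ≤ a → 2 ≤ b → p₀ ℤ.≤ + a → p₁ ℤ.≤ + b →
    MpAtLeast m p₀ → MpAtLeast m p₁ → MpAtLeast (m + (a + b ∸ 1)) (p₀ ℤ.+ p₁)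
  MpAtLeast-glue {m} {a} {b} {p₀} {p₁} 2≤a 2≤b p₀≤a p₁≤b mp₀ mp₁
    with MpAtLeast-truncate a p₀≤a mp₀ | MpAtLeast-truncate b p₁≤b mp₁
  ... | M₀ , mp₀′ , |M₀|≤a , p₀≤|M₀| | M₁ , mp₁′ , |M₁|≤b , p₁≤|M₁| =
    map (extend false L) M₀ ++ map (extend true L) M₁ ,
    glue-IsMultipacking 2≤a 2≤b split mp₀′ |M₀|≤a mp₁′ |M₁|≤b ,
    subst (λ j → p₀ ℤ.+ p₁ ℤ.≤ + j) (sym size) (ℤ.+-mono-≤ p₀≤|M₀| p₁≤|M₁|)
    where
    L = a + b ∸ 1
    split : suc L ≡ a + b
    split = m+[n∸m]≡n (≤-trans (s≤s z≤n) (≤-trans 2≤a (m≤m+n a b)))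
    size : length (map (extend false L) M₀ ++ map (extend true L) M₁) ≡ length M₀ + length M₁
    size = trans (length-++ (map (extend false L) M₀))
                 (cong₂ _+_ (length-map (extend false L) M₀) (length-map (extend true L) M₁))

  max2 : ℤ → ℕ
  max2 p = ∣ p ℤ.⊔ + 2 ∣

  +max2 : ∀ p → + max2 p ≡ p ℤ.⊔ + 2
  +max2 (+ n)      = refl
  +max2 -[1+ n ] = refl

  2≤max2 : ∀ p → 2 ≤ max2 p
  2≤max2 (+ n)      = m≤n⊔m n 2
  2≤max2 -[1+ n ] = ≤-refl

  ≤max2 : ∀ p → p ℤ.≤ + max2 p
  ≤max2 (+ n)      = +≤+ (m≤m⊔n n 2)
  ≤max2 -[1+ n ] = -≤+

  dimension : ∀ {n n₀} p₀ p₁ → + n ≡ + n₀ ℤ.+ (p₀ ℤ.⊔ + 2) ℤ.+ (p₁ ℤ.⊔ + 2) ℤ.- + 1 →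
    n ≡ n₀ + (max2 p₀ + max2 p₁ ∸ 1)
  dimension {n} {n₀} p₀ p₁ eq = ℤ.+-injective (trans eq′ (trans (ℤ.⊖-≥ 1≤) (cong +_ reassoc)))
    where
    a = max2 p₀
    b = max2 p₁
    eq′ : + n ≡ + (n₀ + a + b) ℤ.- + 1
    eq′ = trans eq (cong₂ (λ s t → + n₀ ℤ.+ s ℤ.+ t ℤ.- + 1) (sym (+max2 p₀)) (sym (+max2 p₁)))
    1≤ : 1 ≤ n₀ + a + b
    1≤ = ≤-trans (≤-trans (s≤s z≤n) (2≤max2 p₁)) (m≤n+m b (n₀ + a))
    reassoc : n₀ + a + b ∸ 1 ≡ n₀ + (a + b ∸ 1)
    reassoc = trans (cong (_∸ 1) (+-assoc n₀ a b))
                    (+-∸-assoc n₀ (≤-trans (≤-trans (s≤s z≤n) (2≤max2 p₁)) (m≤n+m b a)))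

open HypercubeGluing using (MpAtLeast-extend; MpAtLeast-glue; max2; 2≤max2; ≤max2; dimension)
open import Data.Nat using (ℕ; _≤_)
open import Data.Integer using (ℤ; +_; _⊔_; _+_; _-_) renaming (_≤_ to _≤ℤ_)
open import Relation.Binary.PropositionalEquality using (_≡_; sym; subst)

corollary2 : (n₀ n₁ : ℕ) → 1 ≤ n₁ → n₁ ≤ n₀ → (p₀ p₁ : ℤ)
           → MpAtLeast n₀ p₀ → MpAtLeast n₁ p₁
           → (n : ℕ) → + n ≡ + n₀ + (p₀ ⊔ + 2) + (p₁ ⊔ + 2) - + 1
           → MpAtLeast n (p₀ + p₁)
corollary2 n₀ n₁ _ n₁≤n₀ p₀ p₁ mp₀ mp₁ n n≡ =
  subst (λ m → MpAtLeast m (p₀ + p₁)) (sym (dimension p₀ p₁ n≡))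
    (MpAtLeast-glue (2≤max2 p₀) (2≤max2 p₁) (≤max2 p₀) (≤max2 p₁) mp₀ (MpAtLeast-extend n₁≤n₀ mp₁))
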